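{- Let $N=(P,T,E,s_0)$ be a 1-safe Petri net, $\mathit{uc}(T)\subseteq T$ a set of uncontrollable transitions, and $I\subseteq 2^P\times T$ a generalized invariant. Consider the two-player game on states of $N$ starting at $s_0$: in each round at current state $s$ (if $s$ is not a deadlock), the constructor chooses a nonempty set of transitions enabled in $s$ that contains all uncontrollable transitions enabled in $s$; then the spoiler picks a transition $t$ from this set, and $t$ is fired. The game ends when a deadlock state is reached. The spoiler wins as soon as she picks a transition $t$ at a state $s$ with $(s,t)\notin I$; the constructor wins if this never happens (on an infinite play or a finite play ending in a deadlock). Then the constructor has a strategy forcing a win if and only if $s_0\in G$, where $G$ is the set of good states defined below.
   Context: A 1-safe Petri net is $N=(P,T,E,s_0)$ with $P$ a finite set of places, states being subsets of $P$, $s_0$ the initial state, $T$ a finite set of transitions, $E\subseteq(P\times T)\cup(T\times P)$. With ${}^\bullet t=\{p\mid(p,t)\in E\}$ and $t^\bullet=\{p\mid(t,p)\in E\}$, $t$ is enabled in $s$ if ${}^\bullet t\subseteq s$ and $t^\bullet\cap s\subseteq{}^\bullet t$, and firing gives $s'=(s\setminus{}^\bullet t)\cup t^\bullet$, written $s\xrightarrow{t}s'$. A state is a deadlock if no transition is enabled. For $J\subseteq 2^P\times T$, $\mathit{reach}_J(N)$ is the set of states reachable from $s_0$ via firings $s\xrightarrow{t}s'$ with $(s,t)\in J$. Attractor: for a set of states $A$, $s\in\mathit{attr}(A)$ iff (i) $s\in A$, or (ii) some uncontrollable $t\in\mathit{uc}(T)$ is enabled in $s$ with $s\xrightarrow{t}s'$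 and either $s'\in A$ or $(s,t)\notin I$, or (iii) $s$ is not a deadlock and for every transition $t$ enabled in $s$ with $s\xrightarrow{t}s'$ and $(s,t)\in I$, we have $s'\in A$. Let $\mathit{attr}^0(A)=A$, $\mathit{attr}^{n+1}(A)=\mathit{attr}(\mathit{attr}^n(A))$, and $\mathit{attr}^*(A)$ the least fixpoint. Let $I_G=\{(s,t)\in I\mid s\xrightarrow{t}s',\ s'\notin\mathit{attr}^*(\emptyset)\}$. Then $G=\mathit{reach}_{I_G}(N)$ if $s_0\notin\mathit{attr}^*(\emptyset)$, and $G=\emptyset$ otherwise. -}

module Defs where

open import Data.Nat using (ℕ; zero; suc)
open import Data.Fin using (Fin)
open import Data.Fin.Subset using (Subset; _∈_; _∉_; _⊆_; _∩_; _∪_; _─_; Nonempty)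
open import Data.Bool using (Bool; true; false)
open import Data.Product using (Σ; ∃; _×_; _,_)
open import Data.Sum using (_⊎_)
open import Data.List using (List; []; _∷_)
open import Data.Empty using (⊥)
open import Relation.Nullary using (¬_)
open import Relation.Binary.PropositionalEquality using (_≡_)

-- The flow relation E ⊆ (P×T) ∪ (T×P) is given by the preset •t
-- (places p with (p,t) ∈ E) and postset t• (places p with (t,p) ∈ E).
record PetriNet : Set where
  field
    nP  : ℕ
    nT  : ℕ
    pre  : Fin nT → Subset nP
    post : Fin nT → Subset nP
    s₀  : Subset nP

module _ (N : PetriNet) where
  open PetriNet N

  State : Set
  State = Subset nP

  Trans : Set
  Trans = Fin nT

  Enabled : State → Trans → Set
  Enabled s t = (pre t ⊆ s) × ((post t ∩ s) ⊆ pre t)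

  fire : State → Trans → State
  fire s t = (s ─ pre t) ∪ post t

  Deadlock : State → Set
  Deadlock s = ¬ (∃ λ t → Enabled s t)

  data Reach (J : State → Trans → Set) : State → Set where
    init : Reach J s₀
    step : ∀ {s t} → Reach J s → Enabled s t → J s t → Reach J (fire s t)

  module _ (uc : Subset nT) (I : State → Trans → Bool) where

    InI : State → Trans → Set
    InI s t = I s t ≡ true

    attr : (State → Set) → (State → Set)
    attr A s =
      A s
      ⊎ (∃ λ t → t ∈ uc × Enabled s t × (A (fire s t) ⊎ ¬ InI s t))
      ⊎ (¬ Deadlock s × (∀ t → Enabled s t → InI s t → A (fire s t)))

    emptySet : State → Set
    emptySet _ = ⊥

    attrⁿ : ℕ → (State → Set) → (State → Set)
    attrⁿ zero    A = A
    attrⁿ (suc k) A = attr (attrⁿ k A)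

    -- attr*(∅): the least fixpoint, i.e. the union of all iterates attrⁿ(∅)
    attr* : State → Set
    attr* s = ∃ λ k → attrⁿ k emptySet s

    I_G : State → Trans → Set
    I_G s t = InI s t × Enabled s t × ¬ attr* (fire s t)

    G : State → Set
    G s = ¬ attr* s₀ × Reach I_G s

    -- A history is the list of (state, transition) pairs of the rounds
    -- played so far, most recent first.
    History : Set
    History = List (State × Trans)

    Strategy : Set
    Strategy = History → State → Subset nT

    LegalChoice : State → Subset nT → Set
    LegalChoice s X =
      Nonempty X
      × (∀ t → t ∈ X → Enabled s t)
      × (∀ t → t ∈ uc → Enabled s t → t ∈ X)

    Legal : Strategy → Set
    Legal σ = ∀ h s → ¬ Deadlock s → LegalChoice s (σ h s)

    data Play (σ : Strategy) : History → State → Set where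
      start : Play σ [] s₀
      move  : ∀ {h s t} → Play σ h s → ¬ Deadlock s → t ∈ σ h s →
              Play σ ((s , t) ∷ h) (fire s t)

    -- the spoiler never picks a pair outside I (on any finite or infinite play)
    Winning : Strategy → Set
    Winning σ = ∀ h s t → Play σ h s → ¬ Deadlock s → t ∈ σ h s → InI s t

    ConstructorWins : Set
    ConstructorWins = ∃ λ σ → Legal σ × Winning σ

-- The constructor wins exactly from the complement of the spoiler's attractor
-- attr*(∅), and s₀ ∈ G just says s₀ ∉ attr*(∅) since s₀ is always reachable.
-- By induction on n, a legal winning strategy never visits attrⁿ(∅): each of
-- the three attractor clauses either lets the spoiler break I at once or lets
-- her move one level down. Conversely, attr*(∅) is closed under attr, so
-- outside it the I-moves leading out of attr*(∅) form a legal choice, and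
-- offering them keeps every play outside attr*(∅) and inside I. Choosing them
-- constructively needs attr*(∅) to be decidable: its iterates form an
-- increasing chain of decidable sets of the finitely many states, which
-- stalls, and once it stalls it is constant.
module Submission where

open import Defs
open import Data.Bool using (Bool; true; false; _≟_)
open import Data.Bool.Properties using (T-≡)
open import Data.Empty using (⊥-elim)
open import Data.Fin using (Fin)
open import Data.Fin.Properties using (any?; all?)
open import Data.Fin.Subset using (Subset; _∈_; _∩_)
open import Data.Fin.Subset.Properties using (_⊆?_; _∈?_)
open import Data.List using (List; []; _∷_; filter; length; cartesianProductWith)
open import Data.List.Membership.Propositional using (lose) renaming (_∈_ to _∈ˡ_)
open import Data.List.Membership.Propositional.Properties using (∈-cartesianProductWith⁺)
open import Data.List.Properties using (length-filter)
open import Data.List.Relation.Binary.Sublist.Propositional using (⊆-refl)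
open import Data.List.Relation.Binary.Sublist.Propositional.Properties using (filter⁺; length-mono-≤)
open import Data.List.Relation.Unary.Any using (Any; here; there) renaming (any? to anyˡ?)
open import Data.Nat using (ℕ; zero; suc; _≤_; _<_; z≤n; s≤s)
open import Data.Nat.Properties using (≤-trans; <⇒≱; m<n⇒m<1+n)
open import Data.Product using (∃; _×_; _,_; proj₁; proj₂; map₂)
open import Data.Sum using (_⊎_; inj₁; inj₂)
open import Data.Vec as Vec using ([]; _∷_; tabulate)
open import Data.Vec.Properties using (lookup∘tabulate; []=⇒lookup; lookup⇒[]=)
open import Function.Bundles using (_⇔_; mk⇔; Equivalence)
open import Relation.Binary.PropositionalEquality using (refl; sym; trans)
open import Relation.Nullary using (¬_; Dec; yes; no)
open import Relation.Nullary.Decidable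
  using (_×-dec_; _⊎-dec_; _→-dec_; ¬?; ⌊_⌋; map′; toWitness; fromWitness; decidable-stable)
open import Relation.Unary using (Decidable)

module _ {A : Set} {P Q : A → Set} (P? : Decidable P) (Q? : Decidable Q)
         (P⇒Q : ∀ {x} → P x → Q x) where

  length-filter-mono : ∀ xs → length (filter P? xs) ≤ length (filter Q? xs)
  length-filter-mono xs = length-mono-≤ (filter⁺ P? Q? (λ { refl → P⇒Q }) (⊆-refl {x = xs}))

  length-filter-strict : ∀ {xs} → Any (λ x → Q x × ¬ P x) xs →
                         length (filter P? xs) < length (filter Q? xs)
  length-filter-strict {x ∷ xs} (here (qx , ¬px)) with P? x | Q? x
  ... | yes px | _      = ⊥-elim (¬px px)
  ... | no _   | yes _  = s≤s (length-filter-mono xs)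
  ... | no _   | no ¬qx = ⊥-elim (¬qx qx)
  length-filter-strict {x ∷ xs} (there new) with P? x | Q? x
  ... | yes _  | yes _  = s≤s (length-filter-strict new)
  ... | yes px | no ¬qx = ⊥-elim (¬qx (P⇒Q px))
  ... | no _   | yes _  = m<n⇒m<1+n (length-filter-strict new)
  ... | no _   | no _   = length-filter-strict new

-- Each proper growth step adds an element of the finite list xs, so within
-- length xs + 1 steps some step adds nothing.
module _ {A : Set} (xs : List A) (enumerates : ∀ x → x ∈ˡ xs)
         (P : ℕ → A → Set) (P? : ∀ k → Decidable (P k))
         (P-step : ∀ k {x} → P k x → P (suc k) x) where

  private
    Stalls : ℕ → Set
    Stalls j = ∀ {x} → P (suc j) x → P j x

    stalls-or-grows : ∀ k → ∃ Stalls ⊎ k ≤ length (filter (P? k) xs)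
    stalls-or-grows zero = inj₂ z≤n
    stalls-or-grows (suc k) with stalls-or-grows k
    ... | inj₁ stall = inj₁ stall
    ... | inj₂ k≤ with anyˡ? (λ x → P? (suc k) x ×-dec ¬? (P? k x)) xs
    ...   | yes new  = inj₂ (≤-trans (s≤s k≤)
                          (length-filter-strict (P? k) (P? (suc k)) (P-step k) new))
    ...   | no ¬new = inj₁ (k , λ {x} p → decidable-stable (P? k x)
                          (λ ¬p → ¬new (lose (enumerates x) (p , ¬p))))

  increasing-chain-stalls : ∃ λ j → ∀ {x} → P (suc j) x → P j x
  increasing-chain-stalls with stalls-or-grows (suc (length xs))
  ... | inj₁ stall = stall
  ... | inj₂ long = ⊥-elim (<⇒≱ long (length-filter (P? _) xs))

allSubsets : ∀ n → List (Subset n)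
allSubsets zero    = [] ∷ []
allSubsets (suc n) = cartesianProductWith Vec._∷_ (true ∷ false ∷ []) (allSubsets n)

∈-allSubsets : ∀ {n} (p : Subset n) → p ∈ˡ allSubsets n
∈-allSubsets []          = here refl
∈-allSubsets (b ∷ p)     =
  ∈-cartesianProductWith⁺ Vec._∷_ {xs = true ∷ false ∷ []} (∈-booleans b) (∈-allSubsets p)
  where
  ∈-booleans : ∀ b → b ∈ˡ true ∷ false ∷ []
  ∈-booleans true  = here refl
  ∈-booleans false = there (here refl)

module _ {n : ℕ} {P : Fin n → Set} (P? : Decidable P) where

  subsetOf : Subset n
  subsetOf = tabulate (λ t → ⌊ P? t ⌋)

  ∈-subsetOf⁺ : ∀ {t} → P t → t ∈ subsetOf
  ∈-subsetOf⁺ {t} p =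
    lookup⇒[]= t subsetOf (trans (lookup∘tabulate _ t) (Equivalence.to T-≡ (fromWitness p)))

  ∈-subsetOf⁻ : ∀ {t} → t ∈ subsetOf → P t
  ∈-subsetOf⁻ {t} t∈ =
    toWitness (Equivalence.from T-≡ (trans (sym (lookup∘tabulate _ t)) ([]=⇒lookup t∈)))

module _ (N : PetriNet) (uc : Subset (PetriNet.nT N))
         (I : Subset (PetriNet.nP N) → Trans N → Bool) where
  open PetriNet N

  private
    Attr : (State N → Set) → State N → Set
    Attr = attr N uc I

    Attr* : State N → Set
    Attr* = attr* N uc I

    Attrⁿ : ℕ → State N → Set
    Attrⁿ k = attrⁿ N uc I k (emptySet N uc I)

  attr-mono : ∀ {A B : State N → Set} → (∀ {s} → A s → B s) → ∀ {s} → Attr A s → Attr B s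
  attr-mono A⇒B (inj₁ a)                             = inj₁ (A⇒B a)
  attr-mono A⇒B (inj₂ (inj₁ (t , u , e , inj₁ a)))   = inj₂ (inj₁ (t , u , e , inj₁ (A⇒B a)))
  attr-mono A⇒B (inj₂ (inj₁ (t , u , e , inj₂ ∉I)))  = inj₂ (inj₁ (t , u , e , inj₂ ∉I))
  attr-mono A⇒B (inj₂ (inj₂ (live , forced)))        = inj₂ (inj₂ (live , λ t e i → A⇒B (forced t e i)))

  Enabled? : ∀ s → Decidable (Enabled N s)
  Enabled? s t = (pre t ⊆? s) ×-dec ((post t ∩ s) ⊆? pre t)

  InI? : ∀ s → Decidable (InI N uc I s)
  InI? s t = I s t ≟ true

  attr? : ∀ {A : State N → Set} → Decidable A → Decidable (Attr A)
  attr? A? s =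
    A? s
    ⊎-dec any? (λ t → (t ∈? uc) ×-dec Enabled? s t ×-dec (A? (fire N s t) ⊎-dec ¬? (InI? s t)))
    ⊎-dec (¬? (¬? (any? (Enabled? s)))
           ×-dec all? (λ t → Enabled? s t →-dec InI? s t →-dec A? (fire N s t)))

  attrⁿ? : ∀ k → Decidable (Attrⁿ k)
  attrⁿ? zero    _ = no λ ()
  attrⁿ? (suc k)   = attr? (attrⁿ? k)

  private
    stall : ∃ λ j → ∀ {s} → Attrⁿ (suc j) s → Attrⁿ j s
    stall = increasing-chain-stalls (allSubsets nP) ∈-allSubsets Attrⁿ attrⁿ? (λ _ → inj₁)

    J : ℕ
    J = proj₁ stall

  attrⁿ⇒attrᴶ : ∀ k {s} → Attrⁿ k s → Attrⁿ J s
  attrⁿ⇒attrᴶ zero    ()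
  attrⁿ⇒attrᴶ (suc k) a = proj₂ stall (attr-mono {B = Attrⁿ J} (attrⁿ⇒attrᴶ k) a)

  attr*? : Decidable Attr*
  attr*? s = map′ (J ,_) (λ (k , a) → attrⁿ⇒attrᴶ k a) (attrⁿ? J s)

  attr*-closed : ∀ {s} → Attr Attr* s → Attr* s
  attr*-closed a = suc J , attr-mono {A = Attr*} (λ (k , b) → attrⁿ⇒attrᴶ k b) a

  enabled⇒live : ∀ {s t} → Enabled N s t → ¬ Deadlock N s
  enabled⇒live {t = t} e dead = dead (t , e)

  I_G? : ∀ s → Decidable (I_G N uc I s)
  I_G? s t = InI? s t ×-dec Enabled? s t ×-dec ¬? (attr*? (fire N s t))

  uncontrollable-move-safe : ∀ {s t} → ¬ Attr* s → t ∈ uc → Enabled N s t → I_G N uc I s t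
  uncontrollable-move-safe {s} {t} s∉ u e =
      decidable-stable (InI? s t) (λ ∉I → s∉ (attr*-closed (inj₂ (inj₁ (t , u , e , inj₂ ∉I)))))
    , e
    , λ s′∈ → s∉ (attr*-closed (inj₂ (inj₁ (t , u , e , inj₁ s′∈))))

  safe-move-exists : ∀ {s} → ¬ Attr* s → ¬ Deadlock N s → ∃ (I_G N uc I s)
  safe-move-exists {s} s∉ live = decidable-stable (any? (I_G? s)) λ none →
    s∉ (attr*-closed (inj₂ (inj₂ (live , λ t e i →
      decidable-stable (attr*? (fire N s t)) (λ s′∉ → none (t , i , e , s′∉))))))

  -- States in attr*(∅) are never reached from s₀ ∉ attr*(∅), so there any legal
  -- choice will do.
  choice : ∀ s → Dec (Attr* s) → Subset nT
  choice s (yes _) = subsetOf (Enabled? s)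
  choice s (no _)  = subsetOf (I_G? s)

  choice-legal : ∀ s (d : Dec (Attr* s)) → ¬ Deadlock N s → LegalChoice N uc I s (choice s d)
  choice-legal s (yes _) live =
    map₂ (∈-subsetOf⁺ (Enabled? s)) (decidable-stable (any? (Enabled? s)) live) ,
    (λ _ → ∈-subsetOf⁻ (Enabled? s)) ,
    (λ _ _ → ∈-subsetOf⁺ (Enabled? s))
  choice-legal s (no s∉) live =
    map₂ (∈-subsetOf⁺ (I_G? s)) (safe-move-exists s∉ live) ,
    (λ _ t∈ → proj₁ (proj₂ (∈-subsetOf⁻ (I_G? s) t∈))) ,
    (λ _ u e → ∈-subsetOf⁺ (I_G? s) (uncontrollable-move-safe s∉ u e))

  choice-safe : ∀ {s t} (d : Dec (Attr* s)) → ¬ Attr* s → t ∈ choice s d → I_G N uc I s t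
  choice-safe (yes s∈) s∉ _  = ⊥-elim (s∉ s∈)
  choice-safe {s} (no _) _ t∈ = ∈-subsetOf⁻ (I_G? s) t∈

  attractor-strategy : Strategy N uc I
  attractor-strategy _ s = choice s (attr*? s)

  attractor-strategy-legal : Legal N uc I attractor-strategy
  attractor-strategy-legal _ s = choice-legal s (attr*? s)

  module _ (s₀∉ : ¬ Attr* s₀) where

    attractor-strategy-avoids-attr* : ∀ {h s} → Play N uc I attractor-strategy h s → ¬ Attr* s
    attractor-strategy-avoids-attr* start = s₀∉
    attractor-strategy-avoids-attr* (move {s = s} p _ t∈) =
      proj₂ (proj₂ (choice-safe (attr*? s) (attractor-strategy-avoids-attr* p) t∈))

    attractor-strategy-winning : Winning N uc I attractor-strategy
    attractor-strategy-winning _ s _ p _ t∈ =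
      proj₁ (choice-safe (attr*? s) (attractor-strategy-avoids-attr* p) t∈)

  module _ {τ : Strategy N uc I} (legal : Legal N uc I τ) (winning : Winning N uc I τ) where

    uncontrollable-offered : ∀ {h s t} → t ∈ uc → (e : Enabled N s t) → t ∈ τ h s
    uncontrollable-offered {h} {s} {t} u e = proj₂ (proj₂ (legal h s (enabled⇒live e))) t u e

    winning-play-avoids-attrⁿ : ∀ k {h s} → Play N uc I τ h s → ¬ Attrⁿ k s
    winning-play-avoids-attrⁿ zero _ ()
    winning-play-avoids-attrⁿ (suc k) p (inj₁ a) = winning-play-avoids-attrⁿ k p a
    winning-play-avoids-attrⁿ (suc k) p (inj₂ (inj₁ (t , u , e , inj₁ a))) =
      winning-play-avoids-attrⁿ k (move p (enabled⇒live e) (uncontrollable-offered u e)) a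
    winning-play-avoids-attrⁿ (suc k) {h} {s} p (inj₂ (inj₁ (t , u , e , inj₂ ∉I))) =
      ∉I (winning h s t p (enabled⇒live e) (uncontrollable-offered u e))
    winning-play-avoids-attrⁿ (suc k) {h} {s} p (inj₂ (inj₂ (live , forced)))
      with (t , t∈) , enabled , _ ← legal h s live =
      winning-play-avoids-attrⁿ k (move p live t∈) (forced t (enabled t t∈) (winning h s t p live t∈))

    winning-play-avoids-attr* : ∀ {h s} → Play N uc I τ h s → ¬ Attr* s
    winning-play-avoids-attr* p (k , a) = winning-play-avoids-attrⁿ k p a

mainTheorem4 : (N : PetriNet) (uc : Subset (PetriNet.nT N))
    (I : Subset (PetriNet.nP N) → Trans N → Bool) →
    ConstructorWins N uc I ⇔ G N uc I (PetriNet.s₀ N)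
mainTheorem4 N uc I = mk⇔
  (λ (τ , legal , winning) → winning-play-avoids-attr* N uc I legal winning start , init)
  (λ (s₀∉ , _) → attractor-strategy N uc I ,
                 attractor-strategy-legal N uc I ,
                 attractor-strategy-winning N uc I s₀∉)
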